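{- Let $\varphi$ be a $\mathbb{BST}$-conjunction, $\psi$ a conjunction of atoms of the form $x=\{y\}$, $x=\{y\}$ a conjunct of $\psi$, and $M$ a set assignment satisfying $\varphi\wedge\Xi^\psi_\varphi$ such that $My\notin Mv$ for every $v\in\mathrm{Vars}(\varphi\wedge\psi)$. Define $M_{x,y}$ by $M_{x,y}v = Mv$ if $Mx\cap Mv=\emptyset$, $M_{x,y}v=(Mv\setminus Mx)\cup\{My\}$ otherwise, for $v\in\mathrm{Vars}(\varphi\wedge\psi)$, and $M_{x,y}\tilde v = M\tilde v$ for the auxiliary variables. Then $M_{x,y}$ satisfies $\varphi\wedge\Xi^\psi_\varphi\wedge x=\{y\}$, and $M_{x,y}y = My$, so that $M_{x,y}x\neq Mx$.
   Context: Set variables range over the von Neumann universe of well-founded sets. A $\mathbb{BST}$-conjunction is a conjunction of literals of the forms $u=v\setminus w$ and $u\neq v\setminus w$. $\mathrm{Vars}(\varphi\wedge\psi)$ is the set of variables occurring in $\varphi\wedge\psi$; for each $v$ in it a new distinct auxiliary variable $\tilde v$ is introduced. $\Xi^\psi_\varphi$ is the conjunction of: (i) $x\not\subseteq y$ for each conjunct $x=\{y\}$ of $\psi$; (ii) $(y=y'\leftrightarrow x=x')$ for each pair of conjuncts $x=\{y\}$, $x'=\{y'\}$ of $\psi$; (iii) $(x\cap v\neq\emptyset\to x\subseteq v)$ for each conjunct $x=\{y\}$ of $\psi$ and each $v\in\mathrm{Vars}(\varphi\wedge\psi)$; (iv) $(x\cap v\neq\emptyset\to\tilde y\subsetneq\tilde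 v)$ for each conjunct $x=\{y\}$ of $\psi$ and $v\in\mathrm{Vars}(\varphi\wedge\psi)$; (v) $(x=y\to\tilde x=\tilde y)$ for all $x,y\in\mathrm{Vars}(\varphi\wedge\psi)$. -}

module Defs where

open import Level using (0ℓ)
open import Data.Empty using (⊥; ⊥-elim)
open import Data.Unit using (⊤; tt)
open import Data.Sum using (_⊎_; inj₁; inj₂)
open import Data.Product using (Σ; _×_; _,_; proj₁)
open import Data.Nat using (ℕ)
open import Data.List using (List; []; _∷_; _++_; concatMap)
open import Data.List.Membership.Propositional using (_∈_)
open import Relation.Nullary using (¬_; Dec; yes; no)
open import Axiom.ExcludedMiddle using (ExcludedMiddle)

-- Well-founded sets: Aczel's model (well-founded trees up to bisimulation).

data V : Set₁ where
  sup : (A : Set) → (A → V) → V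

Idx : V → Set
Idx (sup A f) = A

el : (a : V) → Idx a → V
el (sup A f) = f

infix 4 _≐_ _∈ᵥ_ _⊆_ _⊊_
_≐_ : V → V → Set
sup A f ≐ sup B g = ((a : A) → Σ B λ b → f a ≐ g b) × ((b : B) → Σ A λ a → f a ≐ g b)

_∈ᵥ_ : V → V → Set
z ∈ᵥ a = Σ (Idx a) λ i → z ≐ el a i

_⊆_ : V → V → Set
a ⊆ b = ∀ i → el a i ∈ᵥ b

_⊊_ : V → V → Set
a ⊊ b = (a ⊆ b) × ¬ (a ≐ b)

∅ : V
∅ = sup ⊥ ⊥-elim

｛_｝ : V → V
｛ a ｝ = sup ⊤ (λ _ → a)

infixl 6 _∖_ _∪_
infixl 7 _∩_
_∖_ : V → V → V
a ∖ b = sup (Σ (Idx a) λ i → ¬ (el a i ∈ᵥ b)) (λ p → el a (proj₁ p))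

_∩_ : V → V → V
a ∩ b = sup (Σ (Idx a) λ i → el a i ∈ᵥ b) (λ p → el a (proj₁ p))

_∪_ : V → V → V
a ∪ b = sup (Idx a ⊎ Idx b) λ { (inj₁ i) → el a i ; (inj₂ j) → el b j }

-- Syntax. Variables are natural numbers; the auxiliary variable ṽ of v
-- lives in a separate namespace, so an assignment is a pair of maps
-- (value of v, value of ṽ).

Var : Set
Var = ℕ

data Lit : Set where
  eqDiff  : Var → Var → Var → Lit
  neqDiff : Var → Var → Var → Lit

-- a conjunct x = {y} of ψ is represented by the pair (x , y)
Single : Set
Single = Var × Var

varsLit : Lit → List Var
varsLit (eqDiff u v w)  = u ∷ v ∷ w ∷ []
varsLit (neqDiff u v w) = u ∷ v ∷ w ∷ []

varsSingle : Single → List Var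
varsSingle (x , y) = x ∷ y ∷ []

Vars : List Lit → List Single → List Var
Vars φ ψ = concatMap varsLit φ ++ concatMap varsSingle ψ

Assignment : Set₁
Assignment = Var → V

satLit : Assignment → Lit → Set
satLit M (eqDiff u v w)  = M u ≐ M v ∖ M w
satLit M (neqDiff u v w) = ¬ (M u ≐ M v ∖ M w)

SatBST : Assignment → List Lit → Set
SatBST M φ = ∀ ℓ → ℓ ∈ φ → satLit M ℓ

-- (M , M̃) satisfies Ξ^ψ_φ  (M̃ v is the value of the auxiliary variable ṽ)
SatΞ : List Lit → List Single → Assignment → Assignment → Set
SatΞ φ ψ M M̃ =
  (∀ x y → (x , y) ∈ ψ → ¬ (M x ⊆ M y)) ×
  (∀ x y x' y' → (x , y) ∈ ψ → (x' , y') ∈ ψ →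
     (M y ≐ M y' → M x ≐ M x') × (M x ≐ M x' → M y ≐ M y')) ×
  (∀ x y v → (x , y) ∈ ψ → v ∈ Vars φ ψ →
     ¬ (M x ∩ M v ≐ ∅) → M x ⊆ M v) ×
  (∀ x y v → (x , y) ∈ ψ → v ∈ Vars φ ψ →
     ¬ (M x ∩ M v ≐ ∅) → M̃ y ⊊ M̃ v) ×
  (∀ x y → x ∈ Vars φ ψ → y ∈ Vars φ ψ → M x ≐ M y → M̃ x ≐ M̃ y)

-- The modified assignment M_{x,y} (on the non-auxiliary variables; the
-- auxiliary ones keep their values M̃).  The case distinction on
-- "Mx ∩ Mv = ∅" is made with (classical) excluded middle.

Mxy : ExcludedMiddle 0ℓ → Assignment → Var → Var → Assignment
Mxy em M x y v with em {M x ∩ M v ≐ ∅}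
... | yes _ = M v
... | no  _ = (M v ∖ M x) ∪ ｛ M y ｝

-- Call two assignments Venn-equivalent on a list of variables if they inhabit the same
-- Venn regions, i.e. realise the same membership patterns u ↦ (z ∈ M u).  Every literal of
-- φ ∧ Ξ^ψ_φ only asserts that certain regions are empty or inhabited, so it is invariant
-- under Venn-equivalence.  M_{x,y} is Venn-equivalent to M: it replaces the elements of Mx,
-- which all share one pattern by (iii), with the single fresh element My, which lies in no Mv.
module Submission where

open import Defs
open import Level using (0ℓ)
open import Data.Empty using (⊥-elim)
open import Data.Unit using (tt)
open import Data.Sum using (_⊎_; inj₁; inj₂)
import Data.Sum as ⊎
open import Data.Product using (∃; _×_; _,_; proj₁; proj₂)
open import Data.List using (List; concatMap)
open import Data.List.Membership.Propositional using (_∈_; lose)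
open import Data.List.Membership.Propositional.Properties using (∈-++⁺ˡ; ∈-++⁺ʳ; ∈-concatMap⁺)
open import Data.List.Relation.Unary.All as All using (All; []; _∷_)
open import Data.List.Relation.Unary.Any using (here; there)
open import Function.Base using (_∘_; case_of_)
open import Function.Bundles using (_⇔_; mk⇔; Equivalence)
open import Function.Properties.Equivalence using () renaming (sym to ⇔-sym; trans to ⇔-trans)
open import Relation.Nullary using (¬_; Dec; yes; no)
open import Relation.Binary.PropositionalEquality using (_≡_; refl; sym; subst)
open import Axiom.ExcludedMiddle using (ExcludedMiddle)

open Equivalence using (to; from)

≐-refl : ∀ a → a ≐ a
≐-refl (sup A f) = (λ i → i , ≐-refl (f i)) , (λ i → i , ≐-refl (f i))

≐-sym : ∀ {a b} → a ≐ b → b ≐ a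
≐-sym {sup A f} {sup B g} (a→b , b→a) =
  (λ j → proj₁ (b→a j) , ≐-sym (proj₂ (b→a j))) ,
  (λ i → proj₁ (a→b i) , ≐-sym (proj₂ (a→b i)))

≐-trans : ∀ {a b c} → a ≐ b → b ≐ c → a ≐ c
≐-trans {sup A f} {sup B g} {sup C h} (a→b , b→a) (b→c , c→b) =
  (λ i → let j , fi≐gj = a→b i ; k , gj≐hk = b→c j in k , ≐-trans fi≐gj gj≐hk) ,
  (λ k → let j , gj≐hk = c→b k ; i , fi≐gj = b→a j in i , ≐-trans fi≐gj gj≐hk)

∈ᵥ-respˡ : ∀ {z z′} a → z ≐ z′ → z ∈ᵥ a → z′ ∈ᵥ a
∈ᵥ-respˡ a z≐z′ (i , z≐ai) = i , ≐-trans (≐-sym z≐z′) z≐ai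

∈ᵥ-respʳ : ∀ {z} a b → a ≐ b → z ∈ᵥ a → z ∈ᵥ b
∈ᵥ-respʳ (sup A f) (sup B g) (a→b , _) (i , z≐fi) =
  let j , fi≐gj = a→b i in j , ≐-trans z≐fi fi≐gj

⊆⇒∈ : ∀ {z} a b → a ⊆ b → z ∈ᵥ a → z ∈ᵥ b
⊆⇒∈ a b a⊆b (i , z≐ai) = ∈ᵥ-respˡ b (≐-sym z≐ai) (a⊆b i)

∈⇒⊆ : ∀ a b → (∀ {z} → z ∈ᵥ a → z ∈ᵥ b) → a ⊆ b
∈⇒⊆ a b a→b i = a→b (i , ≐-refl (el a i))

≐⇒⊆ : ∀ a b → a ≐ b → a ⊆ b
≐⇒⊆ a b a≐b = ∈⇒⊆ a b (∈ᵥ-respʳ a b a≐b)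

⊆-antisym : ∀ a b → a ⊆ b → b ⊆ a → a ≐ b
⊆-antisym (sup A f) (sup B g) a⊆b b⊆a =
  a⊆b , (λ j → let i , gj≐fi = b⊆a j in i , ≐-sym gj≐fi)

｛｝-cong : ∀ {a b} → a ≐ b → ｛ a ｝ ≐ ｛ b ｝
｛｝-cong a≐b = (λ _ → tt , a≐b) , (λ _ → tt , a≐b)

∈-｛｝ : ∀ {z} a → z ∈ᵥ ｛ a ｝ ⇔ z ≐ a
∈-｛｝ a = mk⇔ proj₂ (tt ,_)

∈-∪ : ∀ {z} a b → z ∈ᵥ a ∪ b ⇔ (z ∈ᵥ a ⊎ z ∈ᵥ b)
∈-∪ a b = mk⇔
  (λ { (inj₁ i , z≐) → inj₁ (i , z≐) ; (inj₂ j , z≐) → inj₂ (j , z≐) })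
  (λ { (inj₁ (i , z≐)) → inj₁ i , z≐ ; (inj₂ (j , z≐)) → inj₂ j , z≐ })

∈-∖ : ∀ {z} a b → z ∈ᵥ a ∖ b ⇔ (z ∈ᵥ a × ¬ z ∈ᵥ b)
∈-∖ a b = mk⇔
  (λ { ((i , ai∉b) , z≐ai) → (i , z≐ai) , ai∉b ∘ ∈ᵥ-respˡ b z≐ai })
  (λ { ((i , z≐ai) , z∉b) → (i , z∉b ∘ ∈ᵥ-respˡ b (≐-sym z≐ai)) , z≐ai })

∩≐∅⇒disjoint : ∀ {z} a b → a ∩ b ≐ ∅ → z ∈ᵥ a → ¬ z ∈ᵥ b
∩≐∅⇒disjoint a b a∩b≐∅ (i , z≐ai) z∈b =
  proj₁ (∈ᵥ-respʳ (a ∩ b) ∅ a∩b≐∅ ((i , ∈ᵥ-respˡ b z≐ai z∈b) , z≐ai))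

disjoint⇒∩≐∅ : ∀ a b → (∀ {z} → z ∈ᵥ a → ¬ z ∈ᵥ b) → a ∩ b ≐ ∅
disjoint⇒∩≐∅ a b disjoint =
  (λ { (i , ai∈b) → ⊥-elim (disjoint (i , ≐-refl (el a i)) ai∈b) }) , λ ()

⊈⇒self-meets : ∀ a b → ¬ (a ⊆ b) → ¬ (a ∩ a ≐ ∅)
⊈⇒self-meets a b a⊈b a∩a≐∅ =
  a⊈b (∈⇒⊆ a b λ z∈a → ⊥-elim (∩≐∅⇒disjoint a a a∩a≐∅ z∈a z∈a))

∩-inhabited : ExcludedMiddle 0ℓ → ∀ a b → ¬ (a ∩ b ≐ ∅) → ∃ λ z → z ∈ᵥ a × z ∈ᵥ b
∩-inhabited em a b a∩b≢∅ with em {Idx (a ∩ b)}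
... | yes (i , ai∈b) = el a i , (i , ≐-refl (el a i)) , ai∈b
... | no a∩b-empty = ⊥-elim (a∩b≢∅ ((λ i → ⊥-elim (a∩b-empty i)) , λ ()))

lit-vars∈Vars : ∀ {φ} ψ {ℓ} → ℓ ∈ φ → All (_∈ Vars φ ψ) (varsLit ℓ)
lit-vars∈Vars ψ ℓ∈φ = All.tabulate λ u∈ℓ → ∈-++⁺ˡ (∈-concatMap⁺ varsLit (lose ℓ∈φ u∈ℓ))

single-set∈Vars : ∀ φ {ψ x y} → (x , y) ∈ ψ → x ∈ Vars φ ψ
single-set∈Vars φ s∈ψ = ∈-++⁺ʳ (concatMap varsLit φ) (∈-concatMap⁺ varsSingle (lose s∈ψ (here refl)))

single-elem∈Vars : ∀ φ {ψ x y} → (x , y) ∈ ψ → y ∈ Vars φ ψ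
single-elem∈Vars φ s∈ψ = ∈-++⁺ʳ (concatMap varsLit φ) (∈-concatMap⁺ varsSingle (lose s∈ψ (there (here refl))))

-- Every Venn region over Vs inhabited under B is inhabited under A.
record _≼⟨_⟩_ (B : Assignment) (Vs : List Var) (A : Assignment) : Set₁ where
  field
    twin : ∀ {u z} → u ∈ Vs → z ∈ᵥ B u →
      ∃ λ z* → ∀ {w} → w ∈ Vs → z ∈ᵥ B w ⇔ z* ∈ᵥ A w

open _≼⟨_⟩_ using (twin)

_≈⟨_⟩_ : Assignment → List Var → Assignment → Set₁
A ≈⟨ Vs ⟩ B = A ≼⟨ Vs ⟩ B × B ≼⟨ Vs ⟩ A

module _ {Vs : List Var} {A B : Assignment} (B≼A : B ≼⟨ Vs ⟩ A) where

  ⊆-transfer : ∀ {u v} → u ∈ Vs → v ∈ Vs → A u ⊆ A v → B u ⊆ B v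
  ⊆-transfer {u} {v} u∈ v∈ Au⊆Av = ∈⇒⊆ (B u) (B v) λ z∈Bu →
    let _ , same = twin B≼A u∈ z∈Bu
    in from (same v∈) (⊆⇒∈ (A u) (A v) Au⊆Av (to (same u∈) z∈Bu))

  ≐-transfer : ∀ {u v} → u ∈ Vs → v ∈ Vs → A u ≐ A v → B u ≐ B v
  ≐-transfer {u} {v} u∈ v∈ Au≐Av = ⊆-antisym (B u) (B v)
    (⊆-transfer u∈ v∈ (≐⇒⊆ (A u) (A v) Au≐Av))
    (⊆-transfer v∈ u∈ (≐⇒⊆ (A v) (A u) (≐-sym Au≐Av)))

  disjoint-transfer : ∀ {u v} → u ∈ Vs → v ∈ Vs → A u ∩ A v ≐ ∅ → B u ∩ B v ≐ ∅
  disjoint-transfer {u} {v} u∈ v∈ Au∩Av≐∅ = disjoint⇒∩≐∅ (B u) (B v) λ z∈Bu z∈Bv →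
    let _ , same = twin B≼A u∈ z∈Bu
    in ∩≐∅⇒disjoint (A u) (A v) Au∩Av≐∅ (to (same u∈) z∈Bu) (to (same v∈) z∈Bv)

  ∖-transfer : ∀ {u v w} → u ∈ Vs → v ∈ Vs → w ∈ Vs →
    A u ≐ A v ∖ A w → B u ≐ B v ∖ B w
  ∖-transfer {u} {v} {w} u∈ v∈ w∈ Au≐Av∖Aw =
    ⊆-antisym (B u) (B v ∖ B w) (∈⇒⊆ (B u) (B v ∖ B w) Bu⊆) (∈⇒⊆ (B v ∖ B w) (B u) ⊆Bu)
    where
    Bu⊆ : ∀ {z} → z ∈ᵥ B u → z ∈ᵥ B v ∖ B w
    Bu⊆ z∈Bu =
      let _ , same = twin B≼A u∈ z∈Bu
          z*∈Av , z*∉Aw = to (∈-∖ (A v) (A w))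
                            (∈ᵥ-respʳ (A u) (A v ∖ A w) Au≐Av∖Aw (to (same u∈) z∈Bu))
      in from (∈-∖ (B v) (B w)) (from (same v∈) z*∈Av , z*∉Aw ∘ to (same w∈))

    ⊆Bu : ∀ {z} → z ∈ᵥ B v ∖ B w → z ∈ᵥ B u
    ⊆Bu z∈Bv∖Bw =
      let z∈Bv , z∉Bw = to (∈-∖ (B v) (B w)) z∈Bv∖Bw
          _ , same = twin B≼A v∈ z∈Bv
          z*∈Av∖Aw = from (∈-∖ (A v) (A w)) (to (same v∈) z∈Bv , z∉Bw ∘ from (same w∈))
      in from (same u∈) (∈ᵥ-respʳ (A v ∖ A w) (A u) (≐-sym Au≐Av∖Aw) z*∈Av∖Aw)

satBST-resp : ∀ φ ψ {A B} → A ≈⟨ Vars φ ψ ⟩ B → SatBST A φ → SatBST B φ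
satBST-resp φ ψ (A≼B , B≼A) satA (eqDiff u v w) ℓ∈φ
  with u∈ ∷ v∈ ∷ w∈ ∷ [] ← lit-vars∈Vars ψ ℓ∈φ
  = ∖-transfer B≼A u∈ v∈ w∈ (satA _ ℓ∈φ)
satBST-resp φ ψ (A≼B , B≼A) satA (neqDiff u v w) ℓ∈φ
  with u∈ ∷ v∈ ∷ w∈ ∷ [] ← lit-vars∈Vars ψ ℓ∈φ
  = satA _ ℓ∈φ ∘ ∖-transfer A≼B u∈ v∈ w∈

satΞ-resp : ∀ φ ψ {A B M̃} → A ≈⟨ Vars φ ψ ⟩ B → SatΞ φ ψ A M̃ → SatΞ φ ψ B M̃
satΞ-resp φ ψ (A≼B , B≼A) (⊈ , singleton-inj , meets⇒⊆ , meets⇒⊊̃ , ≐⇒≐̃) =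
    (λ x y s∈ → ⊈ x y s∈ ∘ ⊆-transfer A≼B (set∈ s∈) (elem∈ s∈))
  , (λ x y x′ y′ s∈ s′∈ →
        (≐-transfer B≼A (set∈ s∈) (set∈ s′∈)
          ∘ proj₁ (singleton-inj x y x′ y′ s∈ s′∈)
          ∘ ≐-transfer A≼B (elem∈ s∈) (elem∈ s′∈))
      , (≐-transfer B≼A (elem∈ s∈) (elem∈ s′∈)
          ∘ proj₂ (singleton-inj x y x′ y′ s∈ s′∈)
          ∘ ≐-transfer A≼B (set∈ s∈) (set∈ s′∈)))
  , (λ x y v s∈ v∈ meets → ⊆-transfer B≼A (set∈ s∈) v∈
        (meets⇒⊆ x y v s∈ v∈ (meets ∘ disjoint-transfer B≼A (set∈ s∈) v∈)))
  , (λ x y v s∈ v∈ meets →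
        meets⇒⊊̃ x y v s∈ v∈ (meets ∘ disjoint-transfer B≼A (set∈ s∈) v∈))
  , λ u v u∈ v∈ → ≐⇒≐̃ u v u∈ v∈ ∘ ≐-transfer A≼B u∈ v∈
  where
  set∈ : ∀ {x y} → (x , y) ∈ ψ → x ∈ Vars φ ψ
  set∈ = single-set∈Vars φ
  elem∈ : ∀ {x y} → (x , y) ∈ ψ → y ∈ Vars φ ψ
  elem∈ = single-elem∈Vars φ

module _ (em : ExcludedMiddle 0ℓ) (M : Assignment) (x y : Var) where

  N : Assignment
  N = Mxy em M x y

  -- Split on this with case_of_: a with-abstraction would also abstract em {…} inside Mxy and block its reduction.
  disjoint? : ∀ v → Dec (M x ∩ M v ≐ ∅)
  disjoint? v = em

  Mxy-disjoint : ∀ {v} → M x ∩ M v ≐ ∅ → N v ≡ M v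
  Mxy-disjoint {v} disjoint with em {M x ∩ M v ≐ ∅}
  ... | yes _ = refl
  ... | no meets = ⊥-elim (meets disjoint)

  Mxy-meets : ∀ {v} → ¬ (M x ∩ M v ≐ ∅) → N v ≡ (M v ∖ M x) ∪ ｛ M y ｝
  Mxy-meets {v} meets with em {M x ∩ M v ≐ ∅}
  ... | yes disjoint = ⊥-elim (meets disjoint)
  ... | no _ = refl

  ∈-Mxy-disjoint : ∀ {v z} → M x ∩ M v ≐ ∅ → z ∈ᵥ N v ⇔ z ∈ᵥ M v
  ∈-Mxy-disjoint disjoint rewrite Mxy-disjoint disjoint = mk⇔ (λ z∈ → z∈) (λ z∈ → z∈)

  ∈-Mxy-meets : ∀ {v z} → ¬ (M x ∩ M v ≐ ∅) →
    z ∈ᵥ N v ⇔ ((z ∈ᵥ M v × ¬ z ∈ᵥ M x) ⊎ z ≐ M y)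
  ∈-Mxy-meets {v} meets rewrite Mxy-meets meets = mk⇔
    (⊎.map (to (∈-∖ (M v) (M x))) (to (∈-｛｝ (M y))) ∘ to (∈-∪ (M v ∖ M x) ｛ M y ｝))
    (from (∈-∪ (M v ∖ M x) ｛ M y ｝) ∘ ⊎.map (from (∈-∖ (M v) (M x))) (from (∈-｛｝ (M y))))

  My∈Mxy : ∀ {v} → ¬ (M x ∩ M v ≐ ∅) → M y ∈ᵥ N v
  My∈Mxy meets = from (∈-Mxy-meets meets) (inj₂ (≐-refl (M y)))

  ∈-Mxy-outside : ∀ {z} v → ¬ z ∈ᵥ M x → ¬ z ≐ M y → z ∈ᵥ M v ⇔ z ∈ᵥ N v
  ∈-Mxy-outside {z} v z∉Mx z≢My = case disjoint? v of λ where
      (yes disjoint) → ⇔-sym (∈-Mxy-disjoint disjoint)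
      (no meets) → mk⇔ (λ z∈Mv → from (∈-Mxy-meets meets) (inj₁ (z∈Mv , z∉Mx))) (Nv⊆Mv meets)
    where
    Nv⊆Mv : ¬ (M x ∩ M v ≐ ∅) → z ∈ᵥ N v → z ∈ᵥ M v
    Nv⊆Mv meets z∈Nv with to (∈-Mxy-meets meets) z∈Nv
    ... | inj₁ (z∈Mv , _) = z∈Mv
    ... | inj₂ z≐My = ⊥-elim (z≢My z≐My)

  Mxy-set : ¬ (M x ∩ M x ≐ ∅) → N x ≐ ｛ M y ｝
  Mxy-set meets = ⊆-antisym (N x) ｛ M y ｝
    (∈⇒⊆ (N x) ｛ M y ｝ (from (∈-｛｝ (M y)) ∘ Nx-elem))
    (∈⇒⊆ ｛ M y ｝ (N x) (from (∈-Mxy-meets meets) ∘ inj₂ ∘ to (∈-｛｝ (M y))))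
    where
    Nx-elem : ∀ {z} → z ∈ᵥ N x → z ≐ M y
    Nx-elem z∈Nx with to (∈-Mxy-meets meets) z∈Nx
    ... | inj₁ (z∈Mx , z∉Mx) = ⊥-elim (z∉Mx z∈Mx)
    ... | inj₂ z≐My = z≐My

  module _ {Vs : List Var}
    (meets⇒⊆ : ∀ v → v ∈ Vs → ¬ (M x ∩ M v ≐ ∅) → M x ⊆ M v)
    (My∉ : ∀ v → v ∈ Vs → ¬ M y ∈ᵥ M v) where

    ∈M⇒≢My : ∀ {z v} → v ∈ Vs → z ∈ᵥ M v → ¬ z ≐ M y
    ∈M⇒≢My {v = v} v∈ z∈Mv z≐My = My∉ v v∈ (∈ᵥ-respˡ (M v) z≐My z∈Mv)

    ∈-Mxy-collapse : ∀ {z v} → z ∈ᵥ M x → v ∈ Vs → z ∈ᵥ M v ⇔ M y ∈ᵥ N v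
    ∈-Mxy-collapse {z} {v} z∈Mx v∈ = case disjoint? v of λ where
      (yes disjoint) → mk⇔
        (⊥-elim ∘ ∩≐∅⇒disjoint (M x) (M v) disjoint z∈Mx)
        (⊥-elim ∘ My∉ v v∈ ∘ to (∈-Mxy-disjoint disjoint))
      (no meets) → mk⇔ (λ _ → My∈Mxy meets) (λ _ → ⊆⇒∈ (M x) (M v) (meets⇒⊆ v v∈ meets) z∈Mx)

    M≼Mxy : M ≼⟨ Vs ⟩ N
    twin M≼Mxy {u} {z} u∈ z∈Mu with em {z ∈ᵥ M x}
    ... | yes z∈Mx = M y , ∈-Mxy-collapse z∈Mx
    ... | no z∉Mx = z , λ {w} _ → ∈-Mxy-outside w z∉Mx (∈M⇒≢My u∈ z∈Mu)

    Mxy≼M : N ≼⟨ Vs ⟩ M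
    twin Mxy≼M {u} {z} u∈ z∈Nu = case disjoint? u of λ where
        (yes disjoint) →
          let z∈Mu = to (∈-Mxy-disjoint disjoint) z∈Nu
              z∉Mx = λ z∈Mx → ∩≐∅⇒disjoint (M x) (M u) disjoint z∈Mx z∈Mu
          in unmoved z∈Mu z∉Mx
        (no meets) → case to (∈-Mxy-meets meets) z∈Nu of λ where
          (inj₁ (z∈Mu , z∉Mx)) → unmoved z∈Mu z∉Mx
          (inj₂ z≐My) →
            let a , a∈Mx , _ = ∩-inhabited em (M x) (M u) meets
            in a , λ {w} w∈ → ⇔-trans
                 (mk⇔ (∈ᵥ-respˡ (N w) z≐My) (∈ᵥ-respˡ (N w) (≐-sym z≐My)))
                 (⇔-sym (∈-Mxy-collapse a∈Mx w∈))
      where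
      unmoved : z ∈ᵥ M u → ¬ z ∈ᵥ M x → ∃ λ z* → ∀ {w} → w ∈ Vs → z ∈ᵥ N w ⇔ z* ∈ᵥ M w
      unmoved z∈Mu z∉Mx = z , λ {w} _ → ⇔-sym (∈-Mxy-outside w z∉Mx (∈M⇒≢My u∈ z∈Mu))

    M≈Mxy : M ≈⟨ Vs ⟩ N
    M≈Mxy = M≼Mxy , Mxy≼M

    Mxy-elem : y ∈ Vs → ¬ (M x ⊆ M y) → N y ≐ M y
    Mxy-elem y∈ x⊈y = case disjoint? y of λ where
      (yes disjoint) → subst (_≐ M y) (sym (Mxy-disjoint disjoint)) (≐-refl (M y))
      (no meets) → ⊥-elim (x⊈y (meets⇒⊆ y y∈ meets))

    Mxy-set≢ : x ∈ Vs → ¬ (M x ∩ M x ≐ ∅) → ¬ (N x ≐ M x)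
    Mxy-set≢ x∈ meets Nx≐Mx = My∉ x x∈ (∈ᵥ-respʳ (N x) (M x) Nx≐Mx (My∈Mxy meets))

lemma8 : (em : ExcludedMiddle 0ℓ) (φ : List Lit) (ψ : List Single) (x y : Var) →
    (x , y) ∈ ψ → (M M̃ : Assignment) →
    SatBST M φ → SatΞ φ ψ M M̃ →
    (∀ v → v ∈ Vars φ ψ → ¬ (M y ∈ᵥ M v)) →
    SatBST (Mxy em M x y) φ × SatΞ φ ψ (Mxy em M x y) M̃ ×
    (Mxy em M x y x ≐ ｛ Mxy em M x y y ｝) ×
    (Mxy em M x y y ≐ M y) × ¬ (Mxy em M x y x ≐ M x)
lemma8 em φ ψ x y xy∈ψ M M̃ satM ΞM My∉ =
    satBST-resp φ ψ M≈N satM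
  , satΞ-resp φ ψ M≈N ΞM
  , ≐-trans (Mxy-set em M x y x-meets) (｛｝-cong (≐-sym Ny≐My))
  , Ny≐My
  , Mxy-set≢ em M x y meets⇒⊆ My∉ (single-set∈Vars φ xy∈ψ) x-meets
  where
  x⊈y : ¬ (M x ⊆ M y)
  x⊈y = proj₁ ΞM x y xy∈ψ

  meets⇒⊆ : ∀ v → v ∈ Vars φ ψ → ¬ (M x ∩ M v ≐ ∅) → M x ⊆ M v
  meets⇒⊆ v = proj₁ (proj₂ (proj₂ ΞM)) x y v xy∈ψ

  x-meets : ¬ (M x ∩ M x ≐ ∅)
  x-meets = ⊈⇒self-meets (M x) (M y) x⊈y

  M≈N : M ≈⟨ Vars φ ψ ⟩ Mxy em M x y
  M≈N = M≈Mxy em M x y meets⇒⊆ My∉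

  Ny≐My : Mxy em M x y y ≐ M y
  Ny≐My = Mxy-elem em M x y meets⇒⊆ My∉ (single-elem∈Vars φ xy∈ψ) x⊈y
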